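{- Let $P$ be a forest with duplications on $\{1,2,\ldots,n\}$, built by some sequence of the construction operations, and let $\mathcal{D}(P)$ be the set of all pairs $\{a,a'\}$ created by the duplication steps of this construction. Then: (i) the pairs in $\mathcal{D}(P)$ are pairwise disjoint: for $\{a,a'\},\{b,b'\}\in\mathcal{D}(P)$, either $\{a,a'\}=\{b,b'\}$ or $\{a,a'\}\cap\{b,b'\}=\emptyset$; (ii) the nonempty connected order ideals of $P$ are exactly the principal ideals $P_{\le p}$ ($p\in P$) and the unions $P_{\le a}\cup P_{\le a'}$ for $\{a,a'\}\in\mathcal{D}(P)$; (iii) the unordered pairs $\{J_1,J_2\}$ of nonempty connected order ideals of $P$ that intersect nontrivially are exactly the pairs $\{P_{\le a},P_{\le a'}\}$ for $\{a,a'\}\in\mathcal{D}(P)$.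
   Context: An order ideal is connected if its induced Hasse diagram is a connected graph. Two order ideals intersect trivially if disjoint or nested, nontrivially otherwise. A forest with duplications is a finite poset obtainable from one-element posets by iterating: (1) disjoint union; (2) hanging $P_2$ below an element $a$ of $P_1$: on $P_1\sqcup P_2$ add relations $p_2<b$ for all $p_2\in P_2$, $b\in P_1$ with $b\ge_{P_1}a$; (3) duplication of a hanger: $a\in P$ is a hanger if $P_{<a}\neq\emptyset$ and every Hasse-diagram path from an element of $P_{<a}$ to an element of $P\setminus P_{\le a}$ passes through $a$; duplicating it adds a new element $a'$ with $p<a'$ iff $p<_P a$ and $a'<p$ iff $a<_P p$; the pair $\{a,a'\}$ is then a duplication pair. -}

module Defs where

open import Data.Nat using (ℕ; zero; suc; _+_)
open import Data.Fin using (Fin; zero; suc; _↑ˡ_; _↑ʳ_; splitAt; inject₁; fromℕ; _≟_)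
open import Data.Fin.Subset using (Subset; _∈_; _∪_; _∩_; _⊆_; Empty)
open import Data.Fin.Permutation using (Permutation′; _⟨$⟩ʳ_; _⟨$⟩ˡ_)
open import Data.Vec using (tabulate)
open import Data.Bool using (Bool; true; false; T; _∧_; not)
open import Data.Maybe using (Maybe; just; nothing)
import Data.Maybe as Maybe
open import Data.List using (List; []; _∷_; map; _++_)
import Data.List.Membership.Propositional as ListMem
open import Data.Sum using (_⊎_; inj₁; inj₂)
open import Data.Product using (_×_; _,_; ∃; ∃-syntax; map₁; map₂)
open import Relation.Nullary using (¬_)
open import Relation.Nullary.Decidable using (⌊_⌋)
open import Relation.Binary.PropositionalEquality using (_≡_; _≢_)
open import Relation.Binary.Construct.Closure.ReflexiveTransitive using (Star)

Order : ℕ → Set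
Order n = Fin n → Fin n → Bool

module _ {n : ℕ} (leq : Order n) where

  _≤ₚ_ : Fin n → Fin n → Set
  x ≤ₚ y = T (leq x y)

  _<ₚ_ : Fin n → Fin n → Set
  x <ₚ y = x ≤ₚ y × x ≢ y

  _⋖_ : Fin n → Fin n → Set
  x ⋖ y = x <ₚ y × (∀ z → ¬ (x <ₚ z × z <ₚ y))

  HasseEdge : Fin n → Fin n → Set
  HasseEdge x y = x ⋖ y ⊎ y ⋖ x

  AvoidEdge : Fin n → Fin n → Fin n → Set
  AvoidEdge a x y = x ≢ a × y ≢ a × HasseEdge x y

  -- a is a hanger: P_{<a} nonempty, and every Hasse path from P_{<a} to
  -- P \ P_{≤a} passes through a (i.e. there is no such path avoiding a).
  Hanger : Fin n → Set
  Hanger a = (∃[ x ] x <ₚ a)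
           × (∀ x y → x <ₚ a → ¬ (y ≤ₚ a) → ¬ Star (AvoidEdge a) x y)

  ↓ : Fin n → Subset n
  ↓ p = tabulate (λ x → leq x p)

  IsIdeal : Subset n → Set
  IsIdeal J = ∀ x y → y ∈ J → x ≤ₚ y → x ∈ J

  InducedEdge : Subset n → Fin n → Fin n → Set
  InducedEdge J x y = x ∈ J × y ∈ J × HasseEdge x y

  IsConnected : Subset n → Set
  IsConnected J = ∀ x y → x ∈ J → y ∈ J → Star (InducedEdge J) x y

  NCIdeal : Subset n → Set
  NCIdeal J = (∃[ x ] x ∈ J) × IsIdeal J × IsConnected J

TrivialIntersection : ∀ {n} → Subset n → Subset n → Set
TrivialIntersection J₁ J₂ = Empty (J₁ ∩ J₂) ⊎ J₁ ⊆ J₂ ⊎ J₂ ⊆ J₁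

NontrivialIntersection : ∀ {n} → Subset n → Subset n → Set
NontrivialIntersection J₁ J₂ = ¬ TrivialIntersection J₁ J₂

pair : ∀ {A B : Set} → (A → B) → A × A → B × B
pair f (x , y) = f x , f y

unionLeq : ∀ {m k} → Order m → Order k → Order (m + k)
unionLeq {m} R S x y = go (splitAt m x) (splitAt m y)
  where
  go : _ → _ → Bool
  go (inj₁ u) (inj₁ v) = R u v
  go (inj₂ u) (inj₂ v) = S u v
  go _        _        = false

-- hang P₂ (on Fin k, second block) below a of P₁ (on Fin m, first block)
hangLeq : ∀ {m k} → Order m → Order k → Fin m → Order (m + k)
hangLeq {m} R S a x y = go (splitAt m x) (splitAt m y)
  where
  go : _ → _ → Bool
  go (inj₁ u) (inj₁ v) = R u v
  go (inj₂ u) (inj₂ v) = S u v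
  go (inj₂ u) (inj₁ v) = R a v
  go (inj₁ u) (inj₂ v) = false

-- view an element of Fin (suc n): old element inject₁ i ↦ just i,
-- new (last) element fromℕ n ↦ nothing
view : ∀ {n} → Fin (suc n) → Maybe (Fin n)
view {zero}  zero    = nothing
view {suc n} zero    = just zero
view {suc n} (suc x) = Maybe.map suc (view x)

-- duplication of a: the new element a' is the last element fromℕ n
dupLeq : ∀ {n} → Order n → Fin n → Order (suc n)
dupLeq {n} R a x y = go (view x) (view y)
  where
  go : Maybe (Fin n) → Maybe (Fin n) → Bool
  go (just u) (just v) = R u v
  go (just u) nothing  = R u a ∧ not ⌊ u ≟ a ⌋
  go nothing  (just v) = R a v ∧ not ⌊ a ≟ v ⌋
  go nothing  nothing  = true

-- relabelling along a permutation σ (new element x corresponds to old σ x)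
relabelLeq : ∀ {n} → Order n → Permutation′ n → Order n
relabelLeq R σ x y = R (σ ⟨$⟩ʳ x) (σ ⟨$⟩ʳ y)

-- FwD n R D : the poset (Fin n, R) is a forest with duplications, built by a
-- construction whose duplication pairs (a , a') are listed in D.
data FwD : (n : ℕ) → Order n → List (Fin n × Fin n) → Set where
  one     : FwD 1 (λ _ _ → true) []
  union   : ∀ {m k R S D E} → FwD m R D → FwD k S E →
            FwD (m + k) (unionLeq R S)
                (map (pair (_↑ˡ k)) D ++ map (pair (m ↑ʳ_)) E)
  hang    : ∀ {m k R S D E} → FwD m R D → FwD k S E → (a : Fin m) →
            FwD (m + k) (hangLeq R S a)
                (map (pair (_↑ˡ k)) D ++ map (pair (m ↑ʳ_)) E)
  dup     : ∀ {n R D} → FwD n R D → (a : Fin n) → Hanger R a →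
            FwD (suc n) (dupLeq R a)
                ((inject₁ a , fromℕ n) ∷ map (pair inject₁) D)
  relabel : ∀ {n R D} → FwD n R D → (σ : Permutation′ n) →
            FwD n (relabelLeq R σ) (map (pair (σ ⟨$⟩ˡ_)) D)

_∈D_ : ∀ {n} → Fin n × Fin n → List (Fin n × Fin n) → Set
p ∈D D = p ListMem.∈ D

SamePair : ∀ {n} → Fin n × Fin n → Fin n × Fin n → Set
SamePair (a , a') (b , b') = (a ≡ b × a' ≡ b') ⊎ (a ≡ b' × a' ≡ b)

DisjointPair : ∀ {n} → Fin n × Fin n → Fin n × Fin n → Set
DisjointPair (a , a') (b , b') = a ≢ b × a ≢ b' × a' ≢ b × a' ≢ b'

module Submission where

-- Every forest with duplications (P, D) satisfies a finite list of structural
-- properties, packaged below as the record DupForest R D: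
--   * R is a partial order;
--   * any two elements are comparable, have disjoint principal ideals
--     ("apart"), or form a duplication pair;
--   * the two members of a pair are incomparable, have the same elements
--     strictly above them ("twins"), and have a common lower bound;
--   * distinct pairs are disjoint (this is part (i)).

open import Defs
open import Data.Nat using (ℕ; zero; suc; _+_)
open import Data.Fin using (Fin; zero; suc; _≟_; _↑ˡ_; _↑ʳ_; splitAt; inject₁; fromℕ)
open import Data.Fin.Properties
  using (any?; splitAt-↑ˡ; splitAt-↑ʳ; ↑ˡ-injective; ↑ʳ-injective;
         inject₁-injective; fromℕ≢inject₁)
open import Data.Fin.Subset using (Subset; _∈_; _∪_; _∩_; _⊆_; _⊂_; Empty)
open import Data.Fin.Subset.Properties
  using (_∈?_; ⊆-refl; ⊆-reflexive; ⊆-antisym; x∈p∪q⁻; x∈p∪q⁺; p∩q⊆p; p∩q⊆q; ∪-comm; ∩-comm; x∈p∩q⁺)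
open import Data.Fin.Subset.Induction using (⊂-wellFounded; ⊃-wellFounded)
open import Data.Fin.Permutation using (Permutation′; _⟨$⟩ʳ_; _⟨$⟩ˡ_; inverseˡ; inverseʳ)
open import Data.Vec using (tabulate)
open import Data.Vec.Properties using (lookup∘tabulate; []=⇒lookup; lookup⇒[]=)
open import Data.Bool using (Bool; true; false; T; _∧_; not)
open import Data.Bool.Properties using (T-≡; T-∧)
open import Data.Maybe using (just; nothing)
open import Data.List using (List; []; _∷_; map; _++_)
open import Data.List.Membership.Propositional.Properties using (∈-map⁺; ∈-map⁻; ∈-++⁺ˡ; ∈-++⁺ʳ; ∈-++⁻)
open import Data.List.Relation.Unary.Any using (here; there)
import Data.List.Membership.DecPropositional as DecMembership
open import Data.Product using (_×_; _,_; ∃-syntax; proj₁; proj₂)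
open import Data.Product.Properties using (≡-dec)
open import Data.Sum using (_⊎_; inj₁; inj₂)
open import Data.Empty using (⊥; ⊥-elim)
open import Function using (flip; _∘_)
open import Function.Bundles using (_⇔_; mk⇔; Equivalence)
open import Induction.WellFounded using (WellFounded; Acc; acc; module Subrelation)
import Relation.Binary.Construct.On as On
open import Relation.Nullary using (¬_; Dec; yes; no)
open import Relation.Nullary.Decidable using (T?; _×-dec_; _⊎-dec_; ¬?; ⌊_⌋; toWitnessFalse; fromWitnessFalse)
open import Relation.Binary.PropositionalEquality
  using (_≡_; _≢_; refl; sym; trans; cong; subst; subst₂)
open import Relation.Binary.Construct.Closure.ReflexiveTransitive using (Star; ε; _◅_; _◅◅_)
import Relation.Binary.Construct.Closure.ReflexiveTransitive as Star

∈-tabulate⁺ : ∀ {n} {f : Fin n → Bool} {x} → T (f x) → x ∈ tabulate f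
∈-tabulate⁺ {f = f} {x} fx = lookup⇒[]= x _ (trans (lookup∘tabulate f x) (Equivalence.to T-≡ fx))

∈-tabulate⁻ : ∀ {n} {f : Fin n → Bool} {x} → x ∈ tabulate f → T (f x)
∈-tabulate⁻ {f = f} {x} x∈ =
  Equivalence.from T-≡ (trans (sym (lookup∘tabulate f x)) ([]=⇒lookup x∈))

module _ {n : ℕ} where

  Paired : List (Fin n × Fin n) → Fin n → Fin n → Set
  Paired D x y = (x , y) ∈D D ⊎ (y , x) ∈D D

  PairsDisjoint : List (Fin n × Fin n) → Set
  PairsDisjoint D = ∀ p q → p ∈D D → q ∈D D → SamePair p q ⊎ DisjointPair p q

  Paired-sym : ∀ {D x y} → Paired D x y → Paired D y x
  Paired-sym (inj₁ xy) = inj₂ xy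
  Paired-sym (inj₂ yx) = inj₁ yx

  Paired? : ∀ D x y → Dec (Paired D x y)
  Paired? D x y = ((x , y) ∈L? D) ⊎-dec ((y , x) ∈L? D)
    where open DecMembership (≡-dec (_≟_ {n}) (_≟_ {n})) renaming (_∈?_ to _∈L?_)

  Paired-++⁺ˡ : ∀ {D E x y} → Paired D x y → Paired (D ++ E) x y
  Paired-++⁺ˡ = Data.Sum.map ∈-++⁺ˡ ∈-++⁺ˡ

  Paired-++⁺ʳ : ∀ D {E x y} → Paired E x y → Paired (D ++ E) x y
  Paired-++⁺ʳ D = Data.Sum.map (∈-++⁺ʳ D) (∈-++⁺ʳ D)

  Paired-++⁻ : ∀ D {E x y} → Paired (D ++ E) x y → Paired D x y ⊎ Paired E x y
  Paired-++⁻ D (inj₁ xy) = Data.Sum.map inj₁ inj₁ (∈-++⁻ D xy)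
  Paired-++⁻ D (inj₂ yx) = Data.Sum.map inj₂ inj₂ (∈-++⁻ D yx)

  DisjointPair-sym : {p q : Fin n × Fin n} → DisjointPair p q → DisjointPair q p
  DisjointPair-sym (ab , ab' , a'b , a'b') = ab ∘ sym , a'b ∘ sym , ab' ∘ sym , a'b' ∘ sym

  PairsDisjoint-++ : ∀ {D E} → PairsDisjoint D → PairsDisjoint E →
    (∀ p q → p ∈D D → q ∈D E → DisjointPair p q) → PairsDisjoint (D ++ E)
  PairsDisjoint-++ {D} disjD disjE cross p q p∈ q∈ with ∈-++⁻ D p∈ | ∈-++⁻ D q∈
  ... | inj₁ p∈D | inj₁ q∈D = disjD p q p∈D q∈D
  ... | inj₂ p∈E | inj₂ q∈E = disjE p q p∈E q∈E
  ... | inj₁ p∈D | inj₂ q∈E = inj₂ (cross p q p∈D q∈E)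
  ... | inj₂ p∈E | inj₁ q∈D = inj₂ (DisjointPair-sym (cross q p q∈D p∈E))

module _ {m n : ℕ} (f : Fin m → Fin n) where

  Paired-map⁺ : ∀ {D x y} → Paired D x y → Paired (map (pair f) D) (f x) (f y)
  Paired-map⁺ (inj₁ xy) = inj₁ (∈-map⁺ (pair f) xy)
  Paired-map⁺ (inj₂ yx) = inj₂ (∈-map⁺ (pair f) yx)

  data PairedImage (D : List (Fin m × Fin m)) : Fin n → Fin n → Set where
    image : ∀ {x y} → Paired D x y → PairedImage D (f x) (f y)

  Paired-map⁻ : ∀ {D x y} → Paired (map (pair f) D) x y → PairedImage D x y
  Paired-map⁻ (inj₁ xy) with ∈-map⁻ (pair f) xy
  ... | _ , x₀y₀ , refl = image (inj₁ x₀y₀)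
  Paired-map⁻ (inj₂ yx) with ∈-map⁻ (pair f) yx
  ... | _ , y₀x₀ , refl = image (inj₂ y₀x₀)

  PairsDisjoint-map : (∀ {x y} → f x ≡ f y → x ≡ y) →
    ∀ {D} → PairsDisjoint D → PairsDisjoint (map (pair f) D)
  PairsDisjoint-map f-inj disj p q p∈ q∈ with ∈-map⁻ (pair f) p∈ | ∈-map⁻ (pair f) q∈
  ... | p₀ , p₀∈ , refl | q₀ , q₀∈ , refl with disj p₀ q₀ p₀∈ q₀∈
  ...   | inj₁ (inj₁ (refl , refl)) = inj₁ (inj₁ (refl , refl))
  ...   | inj₁ (inj₂ (refl , refl)) = inj₁ (inj₂ (refl , refl))
  ...   | inj₂ (ab , ab' , a'b , a'b') =
          inj₂ (ab ∘ f-inj , ab' ∘ f-inj , a'b ∘ f-inj , a'b' ∘ f-inj)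

module OrderNotation {n : ℕ} (R : Order n) where

  infix 4 _≤_ _<_

  _≤_ : Fin n → Fin n → Set
  _≤_ = _≤ₚ_ R

  _<_ : Fin n → Fin n → Set
  _<_ = _<ₚ_ R

  Apart : Fin n → Fin n → Set
  Apart x y = ∀ z → z ≤ x → z ≤ y → ⊥

module _ {n : ℕ} (R : Order n) where
  open OrderNotation R

  record DupForest (D : List (Fin n × Fin n)) : Set where
    field
      reflexive     : ∀ x → x ≤ x
      antisymmetric : ∀ {x y} → x ≤ y → y ≤ x → x ≡ y
      transitive    : ∀ {x y z} → x ≤ y → y ≤ z → x ≤ z
      tetrachotomy  : ∀ x y → x ≤ y ⊎ y ≤ x ⊎ Apart x y ⊎ Paired D x y
      paired-incomparable : ∀ {x y} → Paired D x y → ¬ x ≤ y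
      paired-twins  : ∀ {x y z} → Paired D x y → x < z → y ≤ z
      paired-linked : ∀ {x y} → Paired D x y → ∃[ z ] (z ≤ x × z ≤ y)
      pairs-disjoint : PairsDisjoint D

module Ideals {n : ℕ} (R : Order n) where
  open OrderNotation R

  ∈↓⁺ : ∀ {x p} → x ≤ p → x ∈ ↓ R p
  ∈↓⁺ = ∈-tabulate⁺

  ∈↓⁻ : ∀ {x p} → x ∈ ↓ R p → x ≤ p
  ∈↓⁻ = ∈-tabulate⁻

  U2 : Fin n → Fin n → Subset n
  U2 a b = ↓ R a ∪ ↓ R b

  U2-comm : ∀ a b → U2 a b ≡ U2 b a
  U2-comm a b = ∪-comm (↓ R a) (↓ R b)

  ∈U2⁻ : ∀ {a b x} → x ∈ U2 a b → x ≤ a ⊎ x ≤ b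
  ∈U2⁻ {a} {b} x∈ = Data.Sum.map ∈↓⁻ ∈↓⁻ (x∈p∪q⁻ (↓ R a) (↓ R b) x∈)

  ∈U2⁺ˡ : ∀ {a b x} → x ≤ a → x ∈ U2 a b
  ∈U2⁺ˡ x≤a = x∈p∪q⁺ (inj₁ (∈↓⁺ x≤a))

  ∈U2⁺ʳ : ∀ {a b x} → x ≤ b → x ∈ U2 a b
  ∈U2⁺ʳ x≤b = x∈p∪q⁺ (inj₂ (∈↓⁺ x≤b))

  ideal-∪ : ∀ {J K} → IsIdeal R J → IsIdeal R K → IsIdeal R (J ∪ K)
  ideal-∪ {J} {K} idJ idK x y y∈ x≤y with x∈p∪q⁻ J K y∈
  ... | inj₁ y∈J = x∈p∪q⁺ (inj₁ (idJ x y y∈J x≤y))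
  ... | inj₂ y∈K = x∈p∪q⁺ (inj₂ (idK x y y∈K x≤y))

  path-mono : ∀ {J K} → J ⊆ K → ∀ {x y} → Star (InducedEdge R J) x y → Star (InducedEdge R K) x y
  path-mono J⊆K = Star.map (λ (x∈ , y∈ , e) → J⊆K x∈ , J⊆K y∈ , e)

  path-reverse : ∀ {J x y} → Star (InducedEdge R J) x y → Star (InducedEdge R J) y x
  path-reverse = Star.reverse λ { (x∈ , y∈ , inj₁ c) → y∈ , x∈ , inj₂ c
                                 ; (x∈ , y∈ , inj₂ c) → y∈ , x∈ , inj₁ c }

  connected-via : ∀ {J} t → (∀ x → x ∈ J → Star (InducedEdge R J) x t) → IsConnected R J
  connected-via t reach x y x∈ y∈ = reach x x∈ ◅◅ path-reverse (reach y y∈)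

  connected-⊆ : ∀ {J K t} → IsConnected R J → t ∈ J → t ∈ K →
    (∀ {u v} → u ∈ K → v ∈ J → HasseEdge R u v → v ∈ K) → J ⊆ K
  connected-⊆ {J} {K} {t} conn t∈J t∈K closed {y} y∈J = follow (conn t y t∈J y∈J) t∈K
    where
    follow : ∀ {s u} → Star (InducedEdge R J) s u → s ∈ K → u ∈ K
    follow ε s∈K = s∈K
    follow ((_ , v∈J , e) ◅ path) s∈K = follow path (closed s∈K v∈J e)

  edge-order : ∀ {u v} → HasseEdge R u v → u ≤ v ⊎ v ≤ u
  edge-order (inj₁ ((u≤v , _) , _)) = inj₁ u≤v
  edge-order (inj₂ ((v≤u , _) , _)) = inj₂ v≤u

-- Parts (ii) and (iii) follow from the structural properties alone.

module Consequences {n : ℕ} {R : Order n} {D : List (Fin n × Fin n)} (F : DupForest R D) where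
  open OrderNotation R
  open Ideals R
  open DupForest F

  _≤?_ : ∀ x y → Dec (x ≤ y)
  x ≤? y = T? (R x y)

  _<?_ : ∀ x y → Dec (x < y)
  x <? y = (x ≤? y) ×-dec ¬? (x ≟ y)

  ≤-<-trans : ∀ {x y z} → x ≤ y → y < z → x < z
  ≤-<-trans x≤y (y≤z , y≢z) = transitive x≤y y≤z , λ { refl → y≢z (antisymmetric y≤z x≤y) }

  <-≤-trans : ∀ {x y z} → x < y → y ≤ z → x < z
  <-≤-trans (x≤y , x≢y) y≤z = transitive x≤y y≤z , λ { refl → x≢y (antisymmetric x≤y y≤z) }

  ↓-mono : ∀ {x y} → x ≤ y → ↓ R x ⊆ ↓ R y
  ↓-mono x≤y z∈ = ∈↓⁺ (transitive (∈↓⁻ z∈) x≤y)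

  ↓-strict : ∀ {x y} → x < y → ↓ R x ⊂ ↓ R y
  ↓-strict {x} {y} x<@(x≤y , x≢y) =
    ↓-mono x≤y , y , ∈↓⁺ (reflexive y) , λ y∈ → x≢y (antisymmetric x≤y (∈↓⁻ y∈))

  <-wellFounded : WellFounded _<_
  <-wellFounded = Subrelation.wellFounded ↓-strict (On.wellFounded (↓ R) ⊂-wellFounded)

  >-wellFounded : WellFounded (flip _<_)
  >-wellFounded = Subrelation.wellFounded ↓-strict (On.wellFounded (↓ R) ⊃-wellFounded)

  Maximal : Subset n → Fin n → Set
  Maximal J m = m ∈ J × (∀ {y} → y ∈ J → m ≤ y → y ≡ m)

  maximal-above : ∀ J {x} → x ∈ J → ∃[ m ] (Maximal J m × x ≤ m)
  maximal-above J {x} = climb x (>-wellFounded x)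
    where
    climb : ∀ x → Acc (flip _<_) x → x ∈ J → ∃[ m ] (Maximal J m × x ≤ m)
    climb x (acc higher) x∈ with any? (λ y → (y ∈? J) ×-dec (x <? y))
    ... | yes (y , y∈ , x<y) with climb y (higher x<y) y∈
    ...   | m , max , y≤m = m , max , transitive (proj₁ x<y) y≤m
    climb x (acc higher) x∈ | no nothing-above = x , (x∈ , top) , reflexive x
      where
      top : ∀ {y} → y ∈ J → x ≤ y → y ≡ x
      top {y} y∈ x≤y with y ≟ x
      ... | yes y≡x = y≡x
      ... | no y≢x = ⊥-elim (nothing-above (y , y∈ , x≤y , y≢x ∘ sym))

  -- any x ≤ y is joined to y by a Hasse path inside ↓ y: if nothing lies
  -- strictly between them x ⋖ y, otherwise split at some x < w < y
  path-to : ∀ {x y} → x ≤ y → Star (InducedEdge R (↓ R y)) x y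
  path-to {x} {y} = go (>-wellFounded x) (<-wellFounded y)
    where
    go : ∀ {x y} → Acc (flip _<_) x → Acc _<_ y → x ≤ y → Star (InducedEdge R (↓ R y)) x y
    go {x} {y} accx accy x≤y with x ≟ y
    ... | yes refl = ε
    ... | no x≢y with any? (λ w → (x <? w) ×-dec (w <? y))
    ...   | no nothing-between =
            (∈↓⁺ x≤y , ∈↓⁺ (reflexive y) , inj₁ ((x≤y , x≢y) , λ w p → nothing-between (w , p))) ◅ ε
    go (acc above-x) accy@(acc below-y) x≤y | no _ | yes (w , x<w , w<y) =
      path-mono (↓-mono (proj₁ w<y)) (go (acc above-x) (below-y w<y) (proj₁ x<w))
      ◅◅ go (above-x x<w) accy (proj₁ w<y)

  ↓-ideal : ∀ p → IsIdeal R (↓ R p)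
  ↓-ideal p x y y∈ x≤y = ∈↓⁺ (transitive x≤y (∈↓⁻ y∈))

  ↓-connected : ∀ p → NCIdeal R (↓ R p)
  ↓-connected p = (p , ∈↓⁺ (reflexive p)) , ↓-ideal p ,
                  connected-via p (λ x x∈ → path-to (∈↓⁻ x∈))

  U2-connected : ∀ {a a'} → Paired D a a' → NCIdeal R (U2 a a')
  U2-connected {a} {a'} P =
    (a , ∈U2⁺ˡ (reflexive a)) , ideal-∪ (↓-ideal a) (↓-ideal a') , connected-via a reach
    where
    below-a : ∀ {x} → x ≤ a → Star (InducedEdge R (U2 a a')) x a
    below-a x≤a = path-mono (λ y∈ → ∈U2⁺ˡ (∈↓⁻ y∈)) (path-to x≤a)
    below-a' : ∀ {x} → x ≤ a' → Star (InducedEdge R (U2 a a')) x a'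
    below-a' x≤a' = path-mono (λ y∈ → ∈U2⁺ʳ (∈↓⁻ y∈)) (path-to x≤a')
    -- from a', go down to a common lower bound z of a and a', then up to a
    reach : ∀ x → x ∈ U2 a a' → Star (InducedEdge R (U2 a a')) x a
    reach x x∈ with ∈U2⁻ {a = a} {b = a'} x∈ | paired-linked P
    ... | inj₁ x≤a  | _ = below-a x≤a
    ... | inj₂ x≤a' | z , z≤a , z≤a' =
      below-a' x≤a' ◅◅ path-reverse (below-a' z≤a') ◅◅ below-a z≤a

  paired-irreflexive : ∀ {x y} → Paired D x y → y ≢ x
  paired-irreflexive P refl = paired-incomparable P (reflexive _)

  -- every element has at most one partner, because distinct pairs are disjoint
  partner-unique : ∀ {x y z} → Paired D x y → Paired D x z → y ≡ z
  partner-unique P@(inj₁ xy) Q@(inj₁ xz) with pairs-disjoint _ _ xy xz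
  ... | inj₁ (inj₁ (_ , y≡z)) = y≡z
  ... | inj₁ (inj₂ (_ , y≡x)) = ⊥-elim (paired-irreflexive P y≡x)
  ... | inj₂ (x≢x , _) = ⊥-elim (x≢x refl)
  partner-unique P@(inj₁ xy) Q@(inj₂ zx) with pairs-disjoint _ _ xy zx
  ... | inj₁ (inj₁ (_ , y≡x)) = ⊥-elim (paired-irreflexive P y≡x)
  ... | inj₁ (inj₂ (_ , y≡z)) = y≡z
  ... | inj₂ (_ , x≢x , _) = ⊥-elim (x≢x refl)
  partner-unique P@(inj₂ yx) Q@(inj₁ xz) with pairs-disjoint _ _ yx xz
  ... | inj₁ (inj₁ (y≡x , _)) = ⊥-elim (paired-irreflexive P y≡x)
  ... | inj₁ (inj₂ (y≡z , _)) = y≡z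
  ... | inj₂ (_ , _ , x≢x , _) = ⊥-elim (x≢x refl)
  partner-unique P@(inj₂ yx) Q@(inj₂ zx) with pairs-disjoint _ _ yx zx
  ... | inj₁ (inj₁ (y≡z , _)) = y≡z
  ... | inj₁ (inj₂ (y≡x , _)) = ⊥-elim (paired-irreflexive P y≡x)
  ... | inj₂ (_ , _ , _ , x≢x) = ⊥-elim (x≢x refl)

  -- a hanger h is never paired: the path from a common lower bound z of h and
  -- its partner b up to b stays inside ↓ b, hence avoids h, and joins an
  -- element below h to one not below h
  hanger-unpaired : ∀ {h b} → Hanger R h → ¬ Paired D h b
  hanger-unpaired {h} {b} (_ , separates) P with paired-linked P
  ... | z , z≤h , z≤b =
    separates z b (z≤h , not-h z≤b) (paired-incomparable (Paired-sym P))
      (Star.map (λ (u∈ , v∈ , e) → not-h (∈↓⁻ u∈) , not-h (∈↓⁻ v∈) , e) (path-to z≤b))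
    where
    not-h : ∀ {u} → u ≤ b → u ≢ h
    not-h u≤b refl = paired-incomparable P u≤b

  partner-maximal : ∀ {J m m'} → Maximal J m → m' ∈ J → Paired D m m' → Maximal J m'
  partner-maximal {J} {m} {m'} (_ , m-top) m'∈ P = m'∈ , m'-top
    where
    m'-top : ∀ {y} → y ∈ J → m' ≤ y → y ≡ m'
    m'-top {y} y∈ m'≤y with y ≟ m'
    ... | yes y≡m' = y≡m'
    ... | no y≢m' = ⊥-elim (paired-incomparable (Paired-sym P)
            (subst (m' ≤_) (m-top y∈ (paired-twins (Paired-sym P) (m'≤y , y≢m' ∘ sym))) m'≤y))

  -- Let m be maximal in J.  An element v of J lying above some
  -- u ≤ m lies below a maximal element w of J; w is not apart from m (u is
  -- below both), so w = m or w is the partner of m.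
  above-shared-bound : ∀ {J m u v} → Maximal J m → v ∈ J → u ≤ m → u ≤ v →
    v ≤ m ⊎ ∃[ m' ] (Paired D m m' × m' ∈ J × v ≤ m')
  above-shared-bound {J} {m} {u} {v} (_ , m-top) v∈ u≤m u≤v with maximal-above J v∈
  ... | w , (w∈ , _) , v≤w with tetrachotomy w m
  ...   | inj₁ w≤m = inj₁ (transitive v≤w w≤m)
  ...   | inj₂ (inj₁ m≤w) = inj₁ (subst (v ≤_) (m-top w∈ m≤w) v≤w)
  ...   | inj₂ (inj₂ (inj₁ apart)) = ⊥-elim (apart u (transitive u≤v v≤w) u≤m)
  ...   | inj₂ (inj₂ (inj₂ P)) = inj₂ (w , Paired-sym P , w∈ , v≤w)

  above-shared-bound-paired : ∀ {J m m' u v} → Maximal J m → Paired D m m' → v ∈ J →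
    u ≤ m → u ≤ v → v ≤ m ⊎ v ≤ m'
  above-shared-bound-paired max P v∈ u≤m u≤v with above-shared-bound max v∈ u≤m u≤v
  ... | inj₁ v≤m = inj₁ v≤m
  ... | inj₂ (m'' , P' , _ , v≤m'') = inj₂ (subst (_ ≤_) (partner-unique P' P) v≤m'')

  unpaired-top : ∀ {J m} → IsIdeal R J → IsConnected R J → Maximal J m →
    ¬ (∃[ m' ] (m' ∈ J × Paired D m m')) → J ≡ ↓ R m
  unpaired-top {J} {m} ideal conn max@(m∈ , _) unpaired =
    ⊆-antisym (connected-⊆ conn m∈ (∈↓⁺ (reflexive m)) closed) (λ y∈ → ideal _ m m∈ (∈↓⁻ y∈))
    where
    closed : ∀ {u v} → u ∈ ↓ R m → v ∈ J → HasseEdge R u v → v ∈ ↓ R m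
    closed {u} {v} u∈ v∈ e with edge-order e
    ... | inj₂ v≤u = ↓-ideal m v u u∈ v≤u
    ... | inj₁ u≤v with above-shared-bound max v∈ (∈↓⁻ u∈) u≤v
    ...   | inj₁ v≤m = ∈↓⁺ v≤m
    ...   | inj₂ (m' , P , m'∈ , _) = ⊥-elim (unpaired (m' , m'∈ , P))

  paired-top : ∀ {J m m'} → IsIdeal R J → IsConnected R J → Maximal J m → m' ∈ J →
    Paired D m m' → J ≡ U2 m m'
  paired-top {J} {m} {m'} ideal conn max@(m∈ , _) m'∈ P =
    ⊆-antisym (connected-⊆ conn m∈ (∈U2⁺ˡ (reflexive m)) closed) U2⊆J
    where
    U2⊆J : U2 m m' ⊆ J
    U2⊆J y∈ with ∈U2⁻ {a = m} {b = m'} y∈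
    ... | inj₁ y≤m = ideal _ m m∈ y≤m
    ... | inj₂ y≤m' = ideal _ m' m'∈ y≤m'
    closed : ∀ {u v} → u ∈ U2 m m' → v ∈ J → HasseEdge R u v → v ∈ U2 m m'
    closed {u} {v} u∈ v∈ e with edge-order e | ∈U2⁻ {a = m} {b = m'} u∈
    ... | inj₂ v≤u | _ = ideal-∪ (↓-ideal m) (↓-ideal m') v u u∈ v≤u
    ... | inj₁ u≤v | inj₁ u≤m =
      Data.Sum.[ ∈U2⁺ˡ , ∈U2⁺ʳ ] (above-shared-bound-paired max P v∈ u≤m u≤v)
    ... | inj₁ u≤v | inj₂ u≤m' =
      Data.Sum.[ ∈U2⁺ʳ , ∈U2⁺ˡ ]
        (above-shared-bound-paired (partner-maximal max m'∈ P) (Paired-sym P) v∈ u≤m' u≤v)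

  PrincipalOrPair : Subset n → Set
  PrincipalOrPair J =
    (∃[ p ] J ≡ ↓ R p) ⊎ (∃[ a ] ∃[ a' ] ((a , a') ∈D D × J ≡ ↓ R a ∪ ↓ R a'))

  classify : ∀ {J} → NCIdeal R J → PrincipalOrPair J
  classify {J} ((x , x∈) , ideal , conn) with maximal-above J x∈
  ... | m , max , _ with any? (λ y → (y ∈? J) ×-dec Paired? D m y)
  ...   | no unpaired = inj₁ (m , unpaired-top ideal conn max unpaired)
  ...   | yes (m' , m'∈ , inj₁ mm') = inj₂ (m , m' , mm' , paired-top ideal conn max m'∈ (inj₁ mm'))
  ...   | yes (m' , m'∈ , inj₂ m'm) =
          inj₂ (m' , m , m'm , trans (paired-top ideal conn max m'∈ (inj₂ m'm)) (U2-comm m m'))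

  ncideal⇔principal-or-pair : ∀ J → NCIdeal R J ⇔ PrincipalOrPair J
  ncideal⇔principal-or-pair J = mk⇔ classify realise
    where
    realise : PrincipalOrPair J → NCIdeal R J
    realise (inj₁ (p , refl)) = ↓-connected p
    realise (inj₂ (a , a' , aa' , refl)) = U2-connected (inj₁ aa')

  Nested : Subset n → Subset n → Set
  Nested A B = A ⊆ B ⊎ B ⊆ A

  trivial-sym : ∀ {A B : Subset n} → TrivialIntersection A B → TrivialIntersection B A
  trivial-sym {A} {B} (inj₁ empty) = inj₁ (subst Empty (∩-comm A B) empty)
  trivial-sym (inj₂ (inj₁ A⊆B)) = inj₂ (inj₂ A⊆B)
  trivial-sym (inj₂ (inj₂ B⊆A)) = inj₂ (inj₁ B⊆A)

  disjoint-∩ : ∀ {A B : Subset n} → (∀ {y} → y ∈ A → y ∈ B → ⊥) → Empty (A ∩ B)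
  disjoint-∩ {A} {B} disjoint (y , y∈) = disjoint (p∩q⊆p A B y∈) (p∩q⊆q A B y∈)

  U2⊆↓ : ∀ {a b c} → a ≤ c → b ≤ c → U2 a b ⊆ ↓ R c
  U2⊆↓ {a} {b} a≤c b≤c y∈ with ∈U2⁻ {a = a} {b = b} y∈
  ... | inj₁ y≤a = ∈↓⁺ (transitive y≤a a≤c)
  ... | inj₂ y≤b = ∈↓⁺ (transitive y≤b b≤c)

  ↓⊆U2 : ∀ {a b c} → c ≤ a → ↓ R c ⊆ U2 a b
  ↓⊆U2 c≤a y∈ = ∈U2⁺ˡ (transitive (∈↓⁻ y∈) c≤a)

  ↓-↓-trivial : ∀ p q → TrivialIntersection (↓ R p) (↓ R q) ⊎ Paired D p q
  ↓-↓-trivial p q with tetrachotomy p q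
  ... | inj₁ p≤q = inj₁ (inj₂ (inj₁ (↓-mono p≤q)))
  ... | inj₂ (inj₁ q≤p) = inj₁ (inj₂ (inj₂ (↓-mono q≤p)))
  ... | inj₂ (inj₂ (inj₁ apart)) = inj₁ (inj₁ (disjoint-∩ λ y∈ y∈' → apart _ (∈↓⁻ y∈) (∈↓⁻ y∈')))
  ... | inj₂ (inj₂ (inj₂ P)) = inj₂ P

  -- comparing p with one member x of a pair {x, x̄}: an element strictly above
  -- x is above x̄ as well, and the only element paired with x is x̄
  ↓-vs-U2 : ∀ p {x x̄} → Paired D x x̄ → Nested (↓ R p) (U2 x x̄) ⊎ Apart p x
  ↓-vs-U2 p {x} P with tetrachotomy p x
  ... | inj₁ p≤x = inj₁ (inj₁ (↓⊆U2 p≤x))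
  ... | inj₂ (inj₂ (inj₁ apart)) = inj₂ apart
  ... | inj₂ (inj₂ (inj₂ Q)) =
        inj₁ (inj₁ (λ y∈ → ∈U2⁺ʳ (subst (_ ≤_) (partner-unique (Paired-sym Q) P) (∈↓⁻ y∈))))
  ... | inj₂ (inj₁ x≤p) with p ≟ x
  ...   | yes refl = inj₁ (inj₁ (↓⊆U2 x≤p))
  ...   | no p≢x = inj₁ (inj₂ (U2⊆↓ x≤p (paired-twins P (x≤p , p≢x ∘ sym))))

  ↓-U2-trivial : ∀ p {a a'} → Paired D a a' → TrivialIntersection (↓ R p) (U2 a a')
  ↓-U2-trivial p {a} {a'} P with ↓-vs-U2 p P | ↓-vs-U2 p (Paired-sym P)
  ... | inj₁ nested | _ = inj₂ nested
  ... | _ | inj₁ nested = inj₂ (subst (Nested (↓ R p)) (U2-comm a' a) nested)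
  ... | inj₂ apart-a | inj₂ apart-a' = inj₁ (disjoint-∩ λ {y} y∈p y∈U2 →
        Data.Sum.[ apart-a y (∈↓⁻ y∈p) , apart-a' y (∈↓⁻ y∈p) ] (∈U2⁻ {a = a} {b = a'} y∈U2))

  U2-vs-U2 : ∀ {x x̄ y ȳ} → Paired D x x̄ → Paired D y ȳ → x ≢ y → x̄ ≢ y →
    Nested (U2 x x̄) (U2 y ȳ) ⊎ Apart x y
  U2-vs-U2 {x} {x̄} {y} {ȳ} P Q x≢y x̄≢y with tetrachotomy x y
  ... | inj₁ x≤y =
        inj₁ (inj₁ (↓⊆U2 (reflexive y) ∘ U2⊆↓ x≤y (paired-twins P (x≤y , x≢y))))
  ... | inj₂ (inj₁ y≤x) =
        inj₁ (inj₂ (↓⊆U2 (reflexive x) ∘ U2⊆↓ y≤x (paired-twins Q (y≤x , x≢y ∘ sym))))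
  ... | inj₂ (inj₂ (inj₁ apart)) = inj₂ apart
  ... | inj₂ (inj₂ (inj₂ P')) = ⊥-elim (x̄≢y (partner-unique P P'))

  -- the unions of two disjoint pairs intersect trivially: unless all four
  -- cross comparisons are apart, one union contains the other
  U2-U2-trivial : ∀ {a a' b b'} → Paired D a a' → Paired D b b' → DisjointPair (a , a') (b , b') →
    TrivialIntersection (U2 a a') (U2 b b')
  U2-U2-trivial {a} {a'} {b} {b'} P Q (a≢b , a≢b' , a'≢b , a'≢b')
    with U2-vs-U2 P Q a≢b a'≢b | U2-vs-U2 P (Paired-sym Q) a≢b' a'≢b'
       | U2-vs-U2 (Paired-sym P) Q a'≢b a≢b | U2-vs-U2 (Paired-sym P) (Paired-sym Q) a'≢b' a≢b'
  ... | inj₁ nested | _ | _ | _ = inj₂ nested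
  ... | _ | inj₁ nested | _ | _ = inj₂ (subst₂ Nested refl (U2-comm b' b) nested)
  ... | _ | _ | inj₁ nested | _ = inj₂ (subst₂ Nested (U2-comm a' a) refl nested)
  ... | _ | _ | _ | inj₁ nested = inj₂ (subst₂ Nested (U2-comm a' a) (U2-comm b' b) nested)
  ... | inj₂ ab | inj₂ ab' | inj₂ a'b | inj₂ a'b' = inj₁ (disjoint-∩ λ {y} y∈ y∈' →
        apart-all y (∈U2⁻ {a = a} {b = a'} y∈) (∈U2⁻ {a = b} {b = b'} y∈'))
    where
    apart-all : ∀ y → y ≤ a ⊎ y ≤ a' → y ≤ b ⊎ y ≤ b' → ⊥
    apart-all y (inj₁ y≤a)  (inj₁ y≤b)  = ab y y≤a y≤b
    apart-all y (inj₁ y≤a)  (inj₂ y≤b') = ab' y y≤a y≤b'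
    apart-all y (inj₂ y≤a') (inj₁ y≤b)  = a'b y y≤a' y≤b
    apart-all y (inj₂ y≤a') (inj₂ y≤b') = a'b' y y≤a' y≤b'

  PairOfIdeals : Subset n → Subset n → Set
  PairOfIdeals J₁ J₂ = ∃[ a ] ∃[ a' ] ((a , a') ∈D D
    × ((J₁ ≡ ↓ R a × J₂ ≡ ↓ R a') ⊎ (J₁ ≡ ↓ R a' × J₂ ≡ ↓ R a)))

  nontrivial⇒pair : ∀ {J₁ J₂} → PrincipalOrPair J₁ → PrincipalOrPair J₂ →
    NontrivialIntersection J₁ J₂ → PairOfIdeals J₁ J₂
  nontrivial⇒pair (inj₁ (p , refl)) (inj₁ (q , refl)) nontrivial with ↓-↓-trivial p q
  ... | inj₁ trivial = ⊥-elim (nontrivial trivial)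
  ... | inj₂ (inj₁ pq) = p , q , pq , inj₁ (refl , refl)
  ... | inj₂ (inj₂ qp) = q , p , qp , inj₂ (refl , refl)
  nontrivial⇒pair (inj₁ (p , refl)) (inj₂ (a , a' , aa' , refl)) nontrivial =
    ⊥-elim (nontrivial (↓-U2-trivial p (inj₁ aa')))
  nontrivial⇒pair (inj₂ (a , a' , aa' , refl)) (inj₁ (p , refl)) nontrivial =
    ⊥-elim (nontrivial (trivial-sym (↓-U2-trivial p (inj₁ aa'))))
  nontrivial⇒pair (inj₂ (a , a' , aa' , refl)) (inj₂ (b , b' , bb' , refl)) nontrivial
    with pairs-disjoint _ _ aa' bb'
  ... | inj₁ (inj₁ (refl , refl)) = ⊥-elim (nontrivial (inj₂ (inj₁ ⊆-refl)))
  ... | inj₁ (inj₂ (refl , refl)) = ⊥-elim (nontrivial (inj₂ (inj₁ (⊆-reflexive (U2-comm a a')))))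
  ... | inj₂ disjoint = ⊥-elim (nontrivial (U2-U2-trivial (inj₁ aa') (inj₁ bb') disjoint))

  -- the two halves of a pair share a lower bound and are incomparable
  pair-nontrivial : ∀ {a a'} → Paired D a a' → NontrivialIntersection (↓ R a) (↓ R a')
  pair-nontrivial P (inj₁ empty) with paired-linked P
  ... | z , z≤a , z≤a' = empty (z , x∈p∩q⁺ (∈↓⁺ z≤a , ∈↓⁺ z≤a'))
  pair-nontrivial {a} P (inj₂ (inj₁ a⊆a')) = paired-incomparable P (∈↓⁻ (a⊆a' (∈↓⁺ (reflexive a))))
  pair-nontrivial {a' = a'} P (inj₂ (inj₂ a'⊆a)) =
    paired-incomparable (Paired-sym P) (∈↓⁻ (a'⊆a (∈↓⁺ (reflexive a'))))

  nontrivial⇔pair : ∀ J₁ J₂ →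
    (NCIdeal R J₁ × NCIdeal R J₂ × NontrivialIntersection J₁ J₂) ⇔ PairOfIdeals J₁ J₂
  nontrivial⇔pair J₁ J₂ = mk⇔
    (λ (nc₁ , nc₂ , nontrivial) → nontrivial⇒pair (classify nc₁) (classify nc₂) nontrivial)
    λ where
      (a , a' , aa' , inj₁ (refl , refl)) → ↓-connected a , ↓-connected a' , pair-nontrivial (inj₁ aa')
      (a , a' , aa' , inj₂ (refl , refl)) → ↓-connected a' , ↓-connected a , pair-nontrivial (inj₂ aa')

one-DupForest : DupForest {1} (λ _ _ → true) []
one-DupForest = record
  { reflexive           = λ _ → _
  ; antisymmetric       = λ { {zero} {zero} _ _ → refl }
  ; transitive          = λ _ _ → _
  ; tetrachotomy        = λ _ _ → inj₁ _
  ; paired-incomparable = λ { (inj₁ ()) ; (inj₂ ()) }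
  ; paired-twins        = λ { (inj₁ ()) ; (inj₂ ()) }
  ; paired-linked       = λ { (inj₁ ()) ; (inj₂ ()) }
  ; pairs-disjoint      = λ _ _ ()
  }

data Side (m k : ℕ) : Fin (m + k) → Set where
  left  : (i : Fin m) → Side m k (i ↑ˡ k)
  right : (j : Fin k) → Side m k (m ↑ʳ j)

side : ∀ m k (x : Fin (m + k)) → Side m k x
side zero    k x       = right x
side (suc m) k zero    = left zero
side (suc m) k (suc x) with side m k x
... | left i  = left (suc i)
... | right j = right j

↑ˡ≢↑ʳ : ∀ {m k} (i : Fin m) (j : Fin k) → i ↑ˡ k ≢ m ↑ʳ j
↑ˡ≢↑ʳ {m} {k} i j eq with trans (sym (splitAt-↑ˡ m i k)) (trans (cong (splitAt m) eq) (splitAt-↑ʳ m k j))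
... | ()

-- Disjoint union and hanging both put a dup-forest P₂ (the right block) next
-- to a dup-forest P₁ (the left block), with P₂ below exactly the elements of an
-- up-set U of P₁ whose members pairwise share lower bounds (U is empty for the
-- union and ↑ a for hanging).

module BlockSum {m k : ℕ} {R : Order m} {S : Order k}
  {D : List (Fin m × Fin m)} {E : List (Fin k × Fin k)}
  (FR : DupForest R D) (FS : DupForest S E)
  (U : Fin m → Bool)
  (U-up : ∀ {v w} → T (U v) → _≤ₚ_ R v w → T (U w))
  (U-linked : ∀ {v w} → T (U v) → T (U w) → ¬ OrderNotation.Apart R v w)
  (Q : Order (m + k))
  (Q-ll : ∀ i j → Q (i ↑ˡ k) (j ↑ˡ k) ≡ R i j)
  (Q-lr : ∀ i j → Q (i ↑ˡ k) (m ↑ʳ j) ≡ false)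
  (Q-rl : ∀ i j → Q (m ↑ʳ i) (j ↑ˡ k) ≡ U j)
  (Q-rr : ∀ i j → Q (m ↑ʳ i) (m ↑ʳ j) ≡ S i j) where

  open OrderNotation Q
  private
    module FR = DupForest FR
    module FS = DupForest FS

  L : Fin m → Fin (m + k)
  L i = i ↑ˡ k

  Rt : Fin k → Fin (m + k)
  Rt j = m ↑ʳ j

  D' : List (Fin (m + k) × Fin (m + k))
  D' = map (pair L) D ++ map (pair Rt) E

  ll⁺ : ∀ {i j} → _≤ₚ_ R i j → L i ≤ L j
  ll⁺ {i} {j} = subst T (sym (Q-ll i j))

  ll⁻ : ∀ {i j} → L i ≤ L j → _≤ₚ_ R i j
  ll⁻ {i} {j} = subst T (Q-ll i j)

  lr⁻ : ∀ {i j} → ¬ L i ≤ Rt j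
  lr⁻ {i} {j} = subst T (Q-lr i j)

  rl⁺ : ∀ {i j} → T (U j) → Rt i ≤ L j
  rl⁺ {i} {j} = subst T (sym (Q-rl i j))

  rl⁻ : ∀ {i j} → Rt i ≤ L j → T (U j)
  rl⁻ {i} {j} = subst T (Q-rl i j)

  rr⁺ : ∀ {i j} → _≤ₚ_ S i j → Rt i ≤ Rt j
  rr⁺ {i} {j} = subst T (sym (Q-rr i j))

  rr⁻ : ∀ {i j} → Rt i ≤ Rt j → _≤ₚ_ S i j
  rr⁻ {i} {j} = subst T (Q-rr i j)

  data BlockPaired : Fin (m + k) → Fin (m + k) → Set where
    in-left  : ∀ {a b} → Paired D a b → BlockPaired (L a) (L b)
    in-right : ∀ {a b} → Paired E a b → BlockPaired (Rt a) (Rt b)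

  block-paired : ∀ {x y} → Paired D' x y → BlockPaired x y
  block-paired P with Paired-++⁻ (map (pair L) D) P
  ... | inj₁ P' with Paired-map⁻ L P'
  ...   | image P₀ = in-left P₀
  block-paired P | inj₂ P' with Paired-map⁻ Rt P'
  ...   | image P₀ = in-right P₀

  reflexive : ∀ x → x ≤ x
  reflexive x with side m k x
  ... | left i  = ll⁺ (FR.reflexive i)
  ... | right j = rr⁺ (FS.reflexive j)

  antisymmetric : ∀ {x y} → x ≤ y → y ≤ x → x ≡ y
  antisymmetric {x} {y} x≤y y≤x with side m k x | side m k y
  ... | left i  | left j  = cong L (FR.antisymmetric (ll⁻ x≤y) (ll⁻ y≤x))
  ... | left i  | right j = ⊥-elim (lr⁻ x≤y)
  ... | right i | left j  = ⊥-elim (lr⁻ y≤x)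
  ... | right i | right j = cong Rt (FS.antisymmetric (rr⁻ x≤y) (rr⁻ y≤x))

  transitive : ∀ {x y z} → x ≤ y → y ≤ z → x ≤ z
  transitive {x} {y} {z} x≤y y≤z with side m k x | side m k y | side m k z
  ... | left i  | left j  | left l  = ll⁺ (FR.transitive (ll⁻ x≤y) (ll⁻ y≤z))
  ... | left i  | left j  | right l = ⊥-elim (lr⁻ y≤z)
  ... | left i  | right j | _       = ⊥-elim (lr⁻ x≤y)
  ... | right i | left j  | left l  = rl⁺ (U-up (rl⁻ x≤y) (ll⁻ y≤z))
  ... | right i | left j  | right l = ⊥-elim (lr⁻ y≤z)
  ... | right i | right j | left l  = rl⁺ (rl⁻ y≤z)
  ... | right i | right j | right l = rr⁺ (FS.transitive (rr⁻ x≤y) (rr⁻ y≤z))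

  apart-left : ∀ {i j} → OrderNotation.Apart R i j → Apart (L i) (L j)
  apart-left apart z z≤i z≤j with side m k z
  ... | left w  = apart w (ll⁻ z≤i) (ll⁻ z≤j)
  ... | right w = U-linked (rl⁻ z≤i) (rl⁻ z≤j) apart

  apart-right : ∀ {i j} → OrderNotation.Apart S i j → Apart (Rt i) (Rt j)
  apart-right apart z z≤i z≤j with side m k z
  ... | left w  = lr⁻ z≤i
  ... | right w = apart w (rr⁻ z≤i) (rr⁻ z≤j)

  apart-across : ∀ {i j} → ¬ T (U i) → Apart (L i) (Rt j)
  apart-across i∉U z z≤i z≤j with side m k z
  ... | left w  = lr⁻ z≤j
  ... | right w = i∉U (rl⁻ z≤i)

  tetrachotomy : ∀ x y → x ≤ y ⊎ y ≤ x ⊎ Apart x y ⊎ Paired D' x y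
  tetrachotomy x y with side m k x | side m k y
  ... | left i | left j with FR.tetrachotomy i j
  ...   | inj₁ i≤j                 = inj₁ (ll⁺ i≤j)
  ...   | inj₂ (inj₁ j≤i)          = inj₂ (inj₁ (ll⁺ j≤i))
  ...   | inj₂ (inj₂ (inj₁ apart)) = inj₂ (inj₂ (inj₁ (apart-left apart)))
  ...   | inj₂ (inj₂ (inj₂ P))     = inj₂ (inj₂ (inj₂ (Paired-++⁺ˡ (Paired-map⁺ L P))))
  tetrachotomy x y | right i | right j with FS.tetrachotomy i j
  ...   | inj₁ i≤j                 = inj₁ (rr⁺ i≤j)
  ...   | inj₂ (inj₁ j≤i)          = inj₂ (inj₁ (rr⁺ j≤i))
  ...   | inj₂ (inj₂ (inj₁ apart)) = inj₂ (inj₂ (inj₁ (apart-right apart)))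
  ...   | inj₂ (inj₂ (inj₂ P))     =
          inj₂ (inj₂ (inj₂ (Paired-++⁺ʳ (map (pair L) D) (Paired-map⁺ Rt P))))
  tetrachotomy x y | left i | right j with T? (U i)
  ...   | yes i∈U = inj₂ (inj₁ (rl⁺ i∈U))
  ...   | no i∉U  = inj₂ (inj₂ (inj₁ (apart-across i∉U)))
  tetrachotomy x y | right j | left i with T? (U i)
  ...   | yes i∈U = inj₁ (rl⁺ i∈U)
  ...   | no i∉U  = inj₂ (inj₂ (inj₁ λ z z≤j z≤i → apart-across i∉U z z≤i z≤j))

  paired-incomparable : ∀ {x y} → Paired D' x y → ¬ x ≤ y
  paired-incomparable P with block-paired P
  ... | in-left P₀  = FR.paired-incomparable P₀ ∘ ll⁻
  ... | in-right P₀ = FS.paired-incomparable P₀ ∘ rr⁻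

  paired-twins : ∀ {x y z} → Paired D' x y → x < z → y ≤ z
  paired-twins {z = z} P (x≤z , x≢z) with block-paired P | side m k z
  ... | in-left P₀  | left w  = ll⁺ (FR.paired-twins P₀ (ll⁻ x≤z , x≢z ∘ cong L))
  ... | in-left P₀  | right w = ⊥-elim (lr⁻ x≤z)
  ... | in-right P₀ | left w  = rl⁺ (rl⁻ x≤z)
  ... | in-right P₀ | right w = rr⁺ (FS.paired-twins P₀ (rr⁻ x≤z , x≢z ∘ cong Rt))

  paired-linked : ∀ {x y} → Paired D' x y → ∃[ z ] (z ≤ x × z ≤ y)
  paired-linked P with block-paired P
  ... | in-left P₀  with FR.paired-linked P₀
  ...   | z , z≤a , z≤b = L z , ll⁺ z≤a , ll⁺ z≤b
  paired-linked P | in-right P₀ with FS.paired-linked P₀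
  ...   | z , z≤a , z≤b = Rt z , rr⁺ z≤a , rr⁺ z≤b

  pairs-disjoint : PairsDisjoint D'
  pairs-disjoint =
    PairsDisjoint-++ (PairsDisjoint-map L (↑ˡ-injective k _ _) FR.pairs-disjoint)
                     (PairsDisjoint-map Rt (↑ʳ-injective m _ _) FS.pairs-disjoint) across
    where
    across : ∀ p q → p ∈D map (pair L) D → q ∈D map (pair Rt) E → DisjointPair p q
    across p q p∈ q∈ with ∈-map⁻ (pair L) p∈ | ∈-map⁻ (pair Rt) q∈
    ... | (a , b) , _ , refl | (c , d) , _ , refl = ↑ˡ≢↑ʳ a c , ↑ˡ≢↑ʳ a d , ↑ˡ≢↑ʳ b c , ↑ˡ≢↑ʳ b d

  dupForest : DupForest Q D'
  dupForest = record
    { reflexive = reflexive ; antisymmetric = antisymmetric ; transitive = transitive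
    ; tetrachotomy = tetrachotomy ; paired-incomparable = paired-incomparable
    ; paired-twins = paired-twins ; paired-linked = paired-linked ; pairs-disjoint = pairs-disjoint }

module _ {m k : ℕ} (R : Order m) (S : Order k) where

  union-ll : ∀ i j → unionLeq R S (i ↑ˡ k) (j ↑ˡ k) ≡ R i j
  union-ll i j rewrite splitAt-↑ˡ m i k | splitAt-↑ˡ m j k = refl

  union-lr : ∀ i j → unionLeq R S (i ↑ˡ k) (m ↑ʳ j) ≡ false
  union-lr i j rewrite splitAt-↑ˡ m i k | splitAt-↑ʳ m k j = refl

  union-rl : ∀ i j → unionLeq R S (m ↑ʳ i) (j ↑ˡ k) ≡ false
  union-rl i j rewrite splitAt-↑ʳ m k i | splitAt-↑ˡ m j k = refl

  union-rr : ∀ i j → unionLeq R S (m ↑ʳ i) (m ↑ʳ j) ≡ S i j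
  union-rr i j rewrite splitAt-↑ʳ m k i | splitAt-↑ʳ m k j = refl

  hang-ll : ∀ a i j → hangLeq R S a (i ↑ˡ k) (j ↑ˡ k) ≡ R i j
  hang-ll a i j rewrite splitAt-↑ˡ m i k | splitAt-↑ˡ m j k = refl

  hang-lr : ∀ a i j → hangLeq R S a (i ↑ˡ k) (m ↑ʳ j) ≡ false
  hang-lr a i j rewrite splitAt-↑ˡ m i k | splitAt-↑ʳ m k j = refl

  hang-rl : ∀ a i j → hangLeq R S a (m ↑ʳ i) (j ↑ˡ k) ≡ R a j
  hang-rl a i j rewrite splitAt-↑ʳ m k i | splitAt-↑ˡ m j k = refl

  hang-rr : ∀ a i j → hangLeq R S a (m ↑ʳ i) (m ↑ʳ j) ≡ S i j
  hang-rr a i j rewrite splitAt-↑ʳ m k i | splitAt-↑ʳ m k j = refl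

union-DupForest : ∀ {m k} {R : Order m} {S : Order k} {D E} → DupForest R D → DupForest S E →
  DupForest (unionLeq R S) (map (pair (_↑ˡ k)) D ++ map (pair (m ↑ʳ_)) E)
union-DupForest {R = R} {S} FR FS =
  BlockSum.dupForest FR FS (λ _ → false) (λ ()) (λ ()) (unionLeq R S)
    (union-ll R S) (union-lr R S) (union-rl R S) (union-rr R S)

-- when hanging below a, the up-set is ↑ a, whose members share the lower bound a
hang-DupForest : ∀ {m k} {R : Order m} {S : Order k} {D E} → DupForest R D → DupForest S E →
  (a : Fin m) → DupForest (hangLeq R S a) (map (pair (_↑ˡ k)) D ++ map (pair (m ↑ʳ_)) E)
hang-DupForest {R = R} {S} FR FS a =
  BlockSum.dupForest FR FS (R a) (DupForest.transitive FR) (λ a≤v a≤w apart → apart a a≤v a≤w)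
    (hangLeq R S a) (hang-ll R S a) (hang-lr R S a) (hang-rl R S a) (hang-rr R S a)

data DupView (n : ℕ) : Fin (suc n) → Set where
  old : (i : Fin n) → DupView n (inject₁ i)
  new : DupView n (fromℕ n)

dup-view : ∀ n (x : Fin (suc n)) → DupView n x
dup-view zero    zero    = new
dup-view (suc n) zero    = old zero
dup-view (suc n) (suc x) with dup-view n x
... | old i = old (suc i)
... | new   = new

view-old : ∀ {n} (i : Fin n) → view (inject₁ i) ≡ just i
view-old {suc n} zero    = refl
view-old {suc n} (suc i) rewrite view-old i = refl

view-new : ∀ n → view (fromℕ n) ≡ nothing
view-new zero    = refl
view-new (suc n) rewrite view-new n = refl

T-<⁺ : ∀ {n} {b : Bool} {x y : Fin n} → T b → x ≢ y → T (b ∧ not ⌊ x ≟ y ⌋)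
T-<⁺ tb x≢y = Equivalence.from T-∧ (tb , fromWitnessFalse x≢y)

T-<⁻ : ∀ {n} {b : Bool} {x y : Fin n} → T (b ∧ not ⌊ x ≟ y ⌋) → T b × x ≢ y
T-<⁻ t with Equivalence.to T-∧ t
... | tb , tn = tb , toWitnessFalse tn

-- Since a is a hanger, it
-- is not yet paired, so the new pair is disjoint from the old ones.

module Duplicate {n : ℕ} {R : Order n} {D : List (Fin n × Fin n)}
  (F : DupForest R D) (h : Fin n) (hanger : Hanger R h) where

  open OrderNotation (dupLeq R h)
  private
    module F = DupForest F
    module C = Consequences F

  ι : Fin n → Fin (suc n)
  ι = inject₁

  ν : Fin (suc n)
  ν = fromℕ n

  D' : List (Fin (suc n) × Fin (suc n))
  D' = (ι h , ν) ∷ map (pair ι) D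

  oo⁺ : ∀ {u v} → _≤ₚ_ R u v → ι u ≤ ι v
  oo⁺ {u} {v} rewrite view-old u | view-old v = λ u≤v → u≤v

  oo⁻ : ∀ {u v} → ι u ≤ ι v → _≤ₚ_ R u v
  oo⁻ {u} {v} rewrite view-old u | view-old v = λ u≤v → u≤v

  on⁺ : ∀ {u} → _<ₚ_ R u h → ι u ≤ ν
  on⁺ {u} (u≤h , u≢h) rewrite view-old u | view-new n = T-<⁺ u≤h u≢h

  on⁻ : ∀ {u} → ι u ≤ ν → _<ₚ_ R u h
  on⁻ {u} rewrite view-old u | view-new n = T-<⁻

  no⁺ : ∀ {v} → _<ₚ_ R h v → ν ≤ ι v
  no⁺ {v} (h≤v , h≢v) rewrite view-old v | view-new n = T-<⁺ h≤v h≢v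

  no⁻ : ∀ {v} → ν ≤ ι v → _<ₚ_ R h v
  no⁻ {v} rewrite view-old v | view-new n = T-<⁻

  nn : ν ≤ ν
  nn rewrite view-new n = _

  reflexive : ∀ x → x ≤ x
  reflexive x with dup-view n x
  ... | old i = oo⁺ (F.reflexive i)
  ... | new   = nn

  not-both : ∀ {u} → _<ₚ_ R u h → _<ₚ_ R h u → ⊥
  not-both (u≤h , u≢h) (h≤u , _) = u≢h (F.antisymmetric u≤h h≤u)

  antisymmetric : ∀ {x y} → x ≤ y → y ≤ x → x ≡ y
  antisymmetric {x} {y} x≤y y≤x with dup-view n x | dup-view n y
  ... | old i | old j = cong ι (F.antisymmetric (oo⁻ x≤y) (oo⁻ y≤x))
  ... | old i | new   = ⊥-elim (not-both (on⁻ x≤y) (no⁻ y≤x))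
  ... | new   | old j = ⊥-elim (not-both (on⁻ y≤x) (no⁻ x≤y))
  ... | new   | new   = refl

  transitive : ∀ {x y z} → x ≤ y → y ≤ z → x ≤ z
  transitive {x} {y} {z} x≤y y≤z with dup-view n x | dup-view n y | dup-view n z
  ... | old i | old j | old l = oo⁺ (F.transitive (oo⁻ x≤y) (oo⁻ y≤z))
  ... | old i | old j | new   = on⁺ (C.≤-<-trans (oo⁻ x≤y) (on⁻ y≤z))
  ... | old i | new   | old l = oo⁺ (F.transitive (proj₁ (on⁻ x≤y)) (proj₁ (no⁻ y≤z)))
  ... | old i | new   | new   = x≤y
  ... | new   | old j | old l = no⁺ (C.<-≤-trans (no⁻ x≤y) (oo⁻ y≤z))
  ... | new   | old j | new   = nn
  ... | new   | new   | old l = y≤z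
  ... | new   | new   | new   = nn

  -- the new element has the same lower bounds as h, apart from h itself
  apart-new : ∀ {u} → OrderNotation.Apart R u h → Apart (ι u) ν
  apart-new apart z z≤u z≤ν with dup-view n z
  ... | old w = apart w (oo⁻ z≤u) (proj₁ (on⁻ z≤ν))
  ... | new   = apart h (proj₁ (no⁻ z≤u)) (F.reflexive h)

  apart-old : ∀ {u v} → OrderNotation.Apart R u v → Apart (ι u) (ι v)
  apart-old apart z z≤u z≤v with dup-view n z
  ... | old w = apart w (oo⁻ z≤u) (oo⁻ z≤v)
  ... | new   = apart h (proj₁ (no⁻ z≤u)) (proj₁ (no⁻ z≤v))

  paired-old : ∀ {a b} → Paired D a b → Paired D' (ι a) (ι b)
  paired-old = Data.Sum.map there there ∘ Paired-map⁺ ι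

  new-pair : Paired D' (ι h) ν
  new-pair = inj₁ (here refl)

  tetrachotomy-new : ∀ u → ι u ≤ ν ⊎ ν ≤ ι u ⊎ Apart (ι u) ν ⊎ Paired D' (ι u) ν
  tetrachotomy-new u with F.tetrachotomy u h | u ≟ h
  ... | _ | yes refl = inj₂ (inj₂ (inj₂ new-pair))
  ... | inj₁ u≤h                 | no u≢h = inj₁ (on⁺ (u≤h , u≢h))
  ... | inj₂ (inj₁ h≤u)          | no u≢h = inj₂ (inj₁ (no⁺ (h≤u , u≢h ∘ sym)))
  ... | inj₂ (inj₂ (inj₁ apart)) | no _   = inj₂ (inj₂ (inj₁ (apart-new apart)))
  ... | inj₂ (inj₂ (inj₂ P))     | no _   = ⊥-elim (C.hanger-unpaired hanger (Paired-sym P))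

  tetrachotomy : ∀ x y → x ≤ y ⊎ y ≤ x ⊎ Apart x y ⊎ Paired D' x y
  tetrachotomy x y with dup-view n x | dup-view n y
  ... | old u | new   = tetrachotomy-new u
  ... | new   | old u with tetrachotomy-new u
  ...   | inj₁ u≤ν                 = inj₂ (inj₁ u≤ν)
  ...   | inj₂ (inj₁ ν≤u)          = inj₁ ν≤u
  ...   | inj₂ (inj₂ (inj₁ apart)) = inj₂ (inj₂ (inj₁ λ z z≤ν z≤u → apart z z≤u z≤ν))
  ...   | inj₂ (inj₂ (inj₂ P))     = inj₂ (inj₂ (inj₂ (Paired-sym P)))
  tetrachotomy x y | new | new = inj₁ nn
  tetrachotomy x y | old u | old v with F.tetrachotomy u v
  ...   | inj₁ u≤v                 = inj₁ (oo⁺ u≤v)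
  ...   | inj₂ (inj₁ v≤u)          = inj₂ (inj₁ (oo⁺ v≤u))
  ...   | inj₂ (inj₂ (inj₁ apart)) = inj₂ (inj₂ (inj₁ (apart-old apart)))
  ...   | inj₂ (inj₂ (inj₂ P))     = inj₂ (inj₂ (inj₂ (paired-old P)))

  data DupPaired : Fin (suc n) → Fin (suc n) → Set where
    new-hν : DupPaired (ι h) ν
    new-νh : DupPaired ν (ι h)
    old    : ∀ {a b} → Paired D a b → DupPaired (ι a) (ι b)

  dup-paired : ∀ {x y} → Paired D' x y → DupPaired x y
  dup-paired (inj₁ (here refl)) = new-hν
  dup-paired (inj₂ (here refl)) = new-νh
  dup-paired (inj₁ (there xy)) with Paired-map⁻ ι (inj₁ xy)
  ... | image P = old P
  dup-paired (inj₂ (there yx)) with Paired-map⁻ ι (inj₂ yx)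
  ... | image P = old P

  paired-incomparable : ∀ {x y} → Paired D' x y → ¬ x ≤ y
  paired-incomparable P with dup-paired P
  ... | new-hν  = λ h≤ν → proj₂ (on⁻ h≤ν) refl
  ... | new-νh  = λ ν≤h → proj₂ (no⁻ ν≤h) refl
  ... | old P₀  = F.paired-incomparable P₀ ∘ oo⁻

  paired-twins : ∀ {x y z} → Paired D' x y → x < z → y ≤ z
  paired-twins {z = z} P (x≤z , x≢z) with dup-paired P | dup-view n z
  ... | new-hν | old w = no⁺ (oo⁻ x≤z , x≢z ∘ cong ι)
  ... | new-hν | new   = nn
  ... | new-νh | old w = oo⁺ (proj₁ (no⁻ x≤z))
  ... | new-νh | new   = ⊥-elim (x≢z refl)
  ... | old P₀ | old w = oo⁺ (F.paired-twins P₀ (oo⁻ x≤z , x≢z ∘ cong ι))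
  ... | old P₀ | new   = on⁺ (F.paired-twins P₀ (on⁻ x≤z) , λ { refl → C.hanger-unpaired hanger (Paired-sym P₀) })

  paired-linked : ∀ {x y} → Paired D' x y → ∃[ z ] (z ≤ x × z ≤ y)
  paired-linked P with dup-paired P | proj₁ hanger
  ... | new-hν | z , z<h = ι z , oo⁺ (proj₁ z<h) , on⁺ z<h
  ... | new-νh | z , z<h = ι z , on⁺ z<h , oo⁺ (proj₁ z<h)
  ... | old P₀ | _ with F.paired-linked P₀
  ...   | z , z≤a , z≤b = ι z , oo⁺ z≤a , oo⁺ z≤b

  pairs-disjoint : PairsDisjoint D'
  pairs-disjoint = PairsDisjoint-++ {D = (ι h , ν) ∷ []} single
    (PairsDisjoint-map ι inject₁-injective F.pairs-disjoint) new-vs-old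
    where
    single : PairsDisjoint ((ι h , ν) ∷ [])
    single _ _ (here refl) (here refl) = inj₁ (inj₁ (refl , refl))
    -- h has no partner yet, and the new element is not an old one
    new-vs-old : ∀ p q → p ∈D ((ι h , ν) ∷ []) → q ∈D map (pair ι) D → DisjointPair p q
    new-vs-old _ q (here refl) q∈ with Paired-map⁻ ι (inj₁ q∈)
    ... | image P = h-unpaired P , h-unpaired (Paired-sym P) , fromℕ≢inject₁ , fromℕ≢inject₁
      where
      h-unpaired : ∀ {a b} → Paired D a b → ι h ≢ ι a
      h-unpaired P h≡a = C.hanger-unpaired hanger (subst (λ a → Paired D a _) (sym (inject₁-injective h≡a)) P)

  dupForest : DupForest (dupLeq R h) D'
  dupForest = record
    { reflexive = reflexive ; antisymmetric = antisymmetric ; transitive = transitive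
    ; tetrachotomy = tetrachotomy ; paired-incomparable = paired-incomparable
    ; paired-twins = paired-twins ; paired-linked = paired-linked ; pairs-disjoint = pairs-disjoint }

module Relabel {n : ℕ} {R : Order n} {D : List (Fin n × Fin n)}
  (F : DupForest R D) (σ : Permutation′ n) where

  open OrderNotation (relabelLeq R σ)
  private
    module F = DupForest F

  D' : List (Fin n × Fin n)
  D' = map (pair (σ ⟨$⟩ˡ_)) D

  σ-injective : ∀ {x y} → σ ⟨$⟩ʳ x ≡ σ ⟨$⟩ʳ y → x ≡ y
  σ-injective {x} {y} eq = trans (sym (inverseˡ σ)) (trans (cong (σ ⟨$⟩ˡ_) eq) (inverseˡ σ))

  σ⁻¹-injective : ∀ {x y} → σ ⟨$⟩ˡ x ≡ σ ⟨$⟩ˡ y → x ≡ y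
  σ⁻¹-injective {x} {y} eq = trans (sym (inverseʳ σ)) (trans (cong (σ ⟨$⟩ʳ_) eq) (inverseʳ σ))

  paired⁺ : ∀ {x y} → Paired D (σ ⟨$⟩ʳ x) (σ ⟨$⟩ʳ y) → Paired D' x y
  paired⁺ P = subst₂ (Paired D') (inverseˡ σ) (inverseˡ σ) (Paired-map⁺ (σ ⟨$⟩ˡ_) P)

  paired⁻ : ∀ {x y} → Paired D' x y → Paired D (σ ⟨$⟩ʳ x) (σ ⟨$⟩ʳ y)
  paired⁻ P with Paired-map⁻ (σ ⟨$⟩ˡ_) P
  ... | image P₀ = subst₂ (Paired D) (sym (inverseʳ σ)) (sym (inverseʳ σ)) P₀

  tetrachotomy : ∀ x y → x ≤ y ⊎ y ≤ x ⊎ Apart x y ⊎ Paired D' x y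
  tetrachotomy x y with F.tetrachotomy (σ ⟨$⟩ʳ x) (σ ⟨$⟩ʳ y)
  ... | inj₁ x≤y                 = inj₁ x≤y
  ... | inj₂ (inj₁ y≤x)          = inj₂ (inj₁ y≤x)
  ... | inj₂ (inj₂ (inj₁ apart)) = inj₂ (inj₂ (inj₁ (λ z → apart (σ ⟨$⟩ʳ z))))
  ... | inj₂ (inj₂ (inj₂ P))     = inj₂ (inj₂ (inj₂ (paired⁺ P)))

  paired-linked : ∀ {x y} → Paired D' x y → ∃[ z ] (z ≤ x × z ≤ y)
  paired-linked P with F.paired-linked (paired⁻ P)
  ... | z , z≤x , z≤y =
    σ ⟨$⟩ˡ z , subst (λ w → _≤ₚ_ R w _) (sym (inverseʳ σ)) z≤x
             , subst (λ w → _≤ₚ_ R w _) (sym (inverseʳ σ)) z≤y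

  dupForest : DupForest (relabelLeq R σ) D'
  dupForest = record
    { reflexive           = λ x → F.reflexive (σ ⟨$⟩ʳ x)
    ; antisymmetric       = λ x≤y y≤x → σ-injective (F.antisymmetric x≤y y≤x)
    ; transitive          = F.transitive
    ; tetrachotomy        = tetrachotomy
    ; paired-incomparable = F.paired-incomparable ∘ paired⁻
    ; paired-twins        = λ P (x≤z , x≢z) → F.paired-twins (paired⁻ P) (x≤z , x≢z ∘ σ-injective)
    ; paired-linked       = paired-linked
    ; pairs-disjoint      = PairsDisjoint-map (σ ⟨$⟩ˡ_) σ⁻¹-injective F.pairs-disjoint
    }

fwd-DupForest : ∀ {n R D} → FwD n R D → DupForest R D
fwd-DupForest one            = one-DupForest
fwd-DupForest (union P₁ P₂)  = union-DupForest (fwd-DupForest P₁) (fwd-DupForest P₂)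
fwd-DupForest (hang P₁ P₂ a) = hang-DupForest (fwd-DupForest P₁) (fwd-DupForest P₂) a
fwd-DupForest (dup P a h)    = Duplicate.dupForest (fwd-DupForest P) a h
fwd-DupForest (relabel P σ)  = Relabel.dupForest (fwd-DupForest P) σ

lemma4p1 : ∀ {n} {R : Order n} {D : List (Fin n × Fin n)} → FwD n R D →
    (∀ p q → p ∈D D → q ∈D D → SamePair p q ⊎ DisjointPair p q)
    × (∀ (J : Subset n) →
         NCIdeal R J ⇔
         ((∃[ p ] J ≡ ↓ R p)
          ⊎ (∃[ a ] ∃[ a' ] ((a , a') ∈D D × J ≡ ↓ R a ∪ ↓ R a'))))
    × (∀ (J₁ J₂ : Subset n) →
         (NCIdeal R J₁ × NCIdeal R J₂ × NontrivialIntersection J₁ J₂) ⇔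
         (∃[ a ] ∃[ a' ] ((a , a') ∈D D
            × ((J₁ ≡ ↓ R a × J₂ ≡ ↓ R a') ⊎ (J₁ ≡ ↓ R a' × J₂ ≡ ↓ R a)))))
lemma4p1 P = DupForest.pairs-disjoint F , ncideal⇔principal-or-pair , nontrivial⇔pair
  where
  F = fwd-DupForest P
  open Consequences F
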